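{- Let $G$ be a connected finite simple graph on $n$ vertices and let $r$ be the number of supporting vertices of $G$. Then the number of vertices of degree $2$ in $G$ is at least $$\binom{n}{2}-\binom{r}{2}-r(n-r)-d_t(G,n-2).$$
   Context: A pendant vertex is a vertex of degree $1$; a supporting vertex is a vertex adjacent to some pendant vertex. A set $D\subseteq V(G)$ is a total dominating set of $G$ if every vertex of $G$ is adjacent to some vertex of $D$; $d_t(G,i)$ denotes the number of total dominating sets of $G$ of size $i$. -}

module Defs where

open import Data.Nat using (ℕ; zero; suc; _+_)
open import Data.Bool using (Bool; true; false)
open import Data.Fin using (Fin; zero; suc)
open import Data.Fin.Properties using (any?; all?)
open import Data.Fin.Subset using (Subset; _∈_; ∣_∣)
open import Data.Fin.Subset.Properties using (_∈?_)
open import Data.Product using (∃; _×_)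
open import Data.Vec using (Vec; []; _∷_)
open import Data.List using (List; []; _∷_; map; _++_; length; filter)
open import Relation.Binary.PropositionalEquality using (_≡_; _≢_)
open import Relation.Nullary using (Dec; yes; no; ¬_)
open import Relation.Nullary.Decidable using (_×-dec_)
open import Data.Bool.Properties using () renaming (_≟_ to _≟B_)
open import Data.Nat.Properties using () renaming (_≟_ to _≟ℕ_)
open import Relation.Binary.Construct.Closure.ReflexiveTransitive using (Star)

record Graph (n : ℕ) : Set where
  field
    adj     : Fin n → Fin n → Bool
    sym     : ∀ u v → adj u v ≡ adj v u
    irrefl  : ∀ v → adj v v ≡ false

open Graph public

Adj : ∀ {n} → Graph n → Fin n → Fin n → Set
Adj G u v = adj G u v ≡ true

Adj? : ∀ {n} (G : Graph n) u v → Dec (Adj G u v)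
Adj? G u v = adj G u v ≟B true

Connected : ∀ {n} → Graph n → Set
Connected G = ∀ u v → Star (Adj G) u v

count : ∀ {n} {P : Fin n → Set} → (∀ v → Dec (P v)) → ℕ
count {zero}  P? = 0
count {suc n} P? with P? zero
... | yes _ = suc (count (λ v → P? (suc v)))
... | no  _ = count (λ v → P? (suc v))

degree : ∀ {n} → Graph n → Fin n → ℕ
degree G v = count (Adj? G v)

Pendant : ∀ {n} → Graph n → Fin n → Set
Pendant G v = degree G v ≡ 1

Supporting : ∀ {n} → Graph n → Fin n → Set
Supporting G v = ∃ λ w → Adj G v w × Pendant G w

Supporting? : ∀ {n} (G : Graph n) v → Dec (Supporting G v)
Supporting? G v = any? (λ w → Adj? G v w ×-dec (degree G w ≟ℕ 1))

numSupporting : ∀ {n} → Graph n → ℕ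
numSupporting G = count (Supporting? G)

numDegree2 : ∀ {n} → Graph n → ℕ
numDegree2 G = count (λ v → degree G v ≟ℕ 2)

TotalDominating : ∀ {n} → Graph n → Subset n → Set
TotalDominating G D = ∀ v → ∃ λ u → u ∈ D × Adj G v u

TotalDominating? : ∀ {n} (G : Graph n) D → Dec (TotalDominating G D)
TotalDominating? G D = all? (λ v → any? (λ u → (u ∈? D) ×-dec Adj? G v u))

allSubsets : ∀ n → List (Subset n)
allSubsets zero = [] ∷ []
allSubsets (suc n) = map (true ∷_) (allSubsets n) ++ map (false ∷_) (allSubsets n)

dt : ∀ {n} → Graph n → ℕ → ℕ
dt {n} G i = length (filter (λ D → TotalDominating? G D ×-dec (∣ D ∣ ≟ℕ i)) (allSubsets n))

module Submission where

-- Let S be the set of non-supporting vertices and r = n - |S|, so that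
-- C(n,2) = C(r,2) + r(n-r) + C(|S|,2). Delete two vertices of S to get a set D of size n-2;
-- those D that are totally dominating are counted by d_t(G,n-2). If D is not, some v has no
-- neighbour in D. Since G is connected, v is not isolated, and v is not pendant, for its neighbour
-- would then be a supporting vertex outside D. Hence v has degree 2 and D = V \ N(v), so the
-- remaining sets D are distinct sets of the form V \ N(v) with deg v = 2.

-- A separate module, so that the ℕ operators used here do not clash with the integer ones of theorem8.
module NaturalBound where

  open import Defs renaming (sym to adj-sym)
  open import Data.Bool using (not)
  open import Data.Bool.Properties using (¬-not) renaming (_≟_ to _≟ᵇ_)
  open import Data.Empty using (⊥-elim)
  open import Data.Fin using (Fin; zero; suc)
  open import Data.Fin.Subset using (Subset; _∈_; ∁; ∣_∣; inside; outside)
  open import Data.Fin.Subset.Properties using (_∈?_; drop-there; ∣p∣≤n; ∣∁p∣≡n∸∣p∣)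
  open import Data.Fin.Properties using (all?; any?; ¬∀⟶∃¬)
  open import Data.List using ([]; _∷_; map; _++_; length; filter)
  open import Data.List.Properties using (length-++; filter-++; filter-none; filter-≐)
  open import Data.List.Relation.Unary.All using (universal)
  open import Data.Nat using (ℕ; zero; suc; _+_; _*_; _∸_; _≤_; _<_; z≤n; s≤s)
  open import Data.Nat.Properties
    using (≤-trans; ≤-antisym; ≤-reflexive; ≤-<-trans; ≤-pred; n≤1+n; m≤n⇒m≤1+n; m≤m+n; suc-injective;
           +-suc; +-identityʳ; +-comm; *-suc; +-monoʳ-≤; +-mono-≤; m∸[m∸n]≡n; m+n∸m≡n; module ≤-Reasoning)
    renaming (_≟_ to _≟ℕ_)
  open import Data.Nat.Combinatorics using (_C_; nCk+nC[k+1]≡[n+1]C[k+1]; nC1≡n)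
  open import Data.Nat.Tactic.RingSolver using (solve-∀)
  open import Data.Product using (∃; _×_; _,_; proj₁; proj₂)
  open import Data.Sum using (_⊎_; inj₁; inj₂; [_,_]′; map₁)
  open import Data.Vec using ([]; _∷_; here; there; lookup; tabulate)
  open import Data.Vec.Properties using (≡-dec; ∷-injective; lookup⇒[]=; tabulate∘lookup; tabulate-cong)
  open import Function using (_∘_; id; case_of_)
  open import Level using (0ℓ)
  open import Relation.Binary.Construct.Closure.ReflexiveTransitive using (_◅_)
  open import Relation.Binary.Definitions using (DecidableEquality)
  open import Relation.Binary.PropositionalEquality using (_≡_; _≢_; refl; sym; trans; cong; cong₂; subst; module ≡-Reasoning)
  open import Relation.Nullary using (Dec; yes; no; ¬_)
  open import Relation.Nullary.Decidable using (_×-dec_; _⊎-dec_; ¬?)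
  open import Relation.Unary using (Pred; Decidable; _⊆_; _∪_; _≐_) renaming (∁ to ∁ᵖ)
  open import Relation.Unary.Properties using (∁?; ∅?)

  count-mono : ∀ {n} {P Q : Pred (Fin n) 0ℓ} (P? : Decidable P) (Q? : Decidable Q) →
               P ⊆ Q → count P? ≤ count Q?
  count-mono {zero}  P? Q? P⊆Q = z≤n
  count-mono {suc n} P? Q? P⊆Q with P? zero | Q? zero
  ... | yes p | yes _ = s≤s (count-mono (P? ∘ suc) (Q? ∘ suc) P⊆Q)
  ... | yes p | no ¬q = ⊥-elim (¬q (P⊆Q p))
  ... | no _  | yes _ = m≤n⇒m≤1+n (count-mono (P? ∘ suc) (Q? ∘ suc) P⊆Q)
  ... | no _  | no _  = count-mono (P? ∘ suc) (Q? ∘ suc) P⊆Q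

  count-mono-< : ∀ {n} {P Q : Pred (Fin n) 0ℓ} (P? : Decidable P) (Q? : Decidable Q) →
                 P ⊆ Q → ∀ {u} → Q u → ¬ P u → count P? < count Q?
  count-mono-< {suc n} P? Q? P⊆Q {zero} q ¬p with P? zero | Q? zero
  ... | yes p | _     = ⊥-elim (¬p p)
  ... | no _  | yes _ = s≤s (count-mono (P? ∘ suc) (Q? ∘ suc) P⊆Q)
  ... | no _  | no ¬q = ⊥-elim (¬q q)
  count-mono-< {suc n} P? Q? P⊆Q {suc u} q ¬p with P? zero | Q? zero
  ... | yes p | yes _ = s≤s (count-mono-< (P? ∘ suc) (Q? ∘ suc) P⊆Q q ¬p)
  ... | yes p | no ¬q = ⊥-elim (¬q (P⊆Q p))
  ... | no _  | yes _ = m≤n⇒m≤1+n (count-mono-< (P? ∘ suc) (Q? ∘ suc) P⊆Q q ¬p)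
  ... | no _  | no _  = count-mono-< (P? ∘ suc) (Q? ∘ suc) P⊆Q q ¬p

  count-pos : ∀ {n} {Q : Pred (Fin n) 0ℓ} (Q? : Decidable Q) → ∀ {u} → Q u → 0 < count Q?
  count-pos Q? q = ≤-<-trans z≤n (count-mono-< ∅? Q? (λ ()) q (λ ()))

  count-cong : ∀ {n} {P Q : Pred (Fin n) 0ℓ} (P? : Decidable P) (Q? : Decidable Q) →
               P ≐ Q → count P? ≡ count Q?
  count-cong P? Q? (P⊆Q , Q⊆P) = ≤-antisym (count-mono P? Q? P⊆Q) (count-mono Q? P? Q⊆P)

  count-yes : ∀ {n} {P : Pred (Fin (suc n)) 0ℓ} (P? : Decidable P) → P zero → count P? ≡ suc (count (P? ∘ suc))
  count-yes P? p with P? zero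
  ... | yes _ = refl
  ... | no ¬p = ⊥-elim (¬p p)

  count-no : ∀ {n} {P : Pred (Fin (suc n)) 0ℓ} (P? : Decidable P) → ¬ P zero → count P? ≡ count (P? ∘ suc)
  count-no P? ¬p with P? zero
  ... | yes p = ⊥-elim (¬p p)
  ... | no _  = refl

  count+count-∁ : ∀ {n} {P : Pred (Fin n) 0ℓ} (P? : Decidable P) → count P? + count (∁? P?) ≡ n
  count+count-∁ {zero}  P? = refl
  count+count-∁ {suc n} P? with P? zero
  ... | yes _ = cong suc (count+count-∁ (P? ∘ suc))
  ... | no _  = trans (+-suc _ _) (cong suc (count+count-∁ (P? ∘ suc)))

  count≤n : ∀ {n} {P : Pred (Fin n) 0ℓ} (P? : Decidable P) → count P? ≤ n
  count≤n P? = ≤-trans (m≤m+n _ _) (≤-reflexive (count+count-∁ P?))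

  count-outside≡∣∁∣ : ∀ {n} (p : Subset n) → count (λ v → lookup p v ≟ᵇ outside) ≡ ∣ ∁ p ∣
  count-outside≡∣∁∣ []            = refl
  count-outside≡∣∁∣ (inside ∷ p)  = count-outside≡∣∁∣ p
  count-outside≡∣∁∣ (outside ∷ p) = cong suc (count-outside≡∣∁∣ p)

  module _ {A : Set} where

    length-filter-++ : ∀ {P : Pred A 0ℓ} (P? : Decidable P) xs ys →
                       length (filter P? (xs ++ ys)) ≡ length (filter P? xs) + length (filter P? ys)
    length-filter-++ P? xs ys = trans (cong length (filter-++ P? xs ys)) (length-++ (filter P? xs))

    length-filter-map : ∀ {B : Set} {P : Pred A 0ℓ} (P? : Decidable P) (f : B → A) xs →
                        length (filter P? (map f xs)) ≡ length (filter (P? ∘ f) xs)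
    length-filter-map P? f []       = refl
    length-filter-map P? f (x ∷ xs) with P? (f x)
    ... | yes _ = cong suc (length-filter-map P? f xs)
    ... | no _  = length-filter-map P? f xs

    length-filter-∅ : ∀ {P : Pred A 0ℓ} (P? : Decidable P) → (∀ x → ¬ P x) → ∀ xs → length (filter P? xs) ≡ 0
    length-filter-∅ P? ¬P xs = cong length (filter-none P? (universal ¬P xs))

    length-filter-≐ : ∀ {P Q : Pred A 0ℓ} (P? : Decidable P) (Q? : Decidable Q) → P ≐ Q → ∀ xs →
                      length (filter P? xs) ≡ length (filter Q? xs)
    length-filter-≐ P? Q? P≐Q xs = cong length (filter-≐ P? Q? P≐Q xs)

    length-filter-∪ : ∀ {P Q R : Pred A 0ℓ} (P? : Decidable P) (Q? : Decidable Q) (R? : Decidable R) →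
                      P ⊆ Q ∪ R → ∀ xs → length (filter P? xs) ≤ length (filter Q? xs) + length (filter R? xs)
    length-filter-∪ P? Q? R? P⊆Q∪R []       = z≤n
    length-filter-∪ P? Q? R? P⊆Q∪R (x ∷ xs) with ih ← length-filter-∪ P? Q? R? P⊆Q∪R xs | P? x | Q? x | R? x
    ... | no _  | no _  | no _  = ih
    ... | no _  | yes _ | no _  = m≤n⇒m≤1+n ih
    ... | no _  | no _  | yes _ = ≤-trans ih (+-monoʳ-≤ _ (n≤1+n _))
    ... | no _  | yes _ | yes _ = m≤n⇒m≤1+n (≤-trans ih (+-monoʳ-≤ _ (n≤1+n _)))
    ... | yes _ | yes _ | no _  = s≤s ih
    ... | yes _ | yes _ | yes _ = s≤s (≤-trans ih (+-monoʳ-≤ _ (n≤1+n _)))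
    ... | yes _ | no _  | yes _ = ≤-trans (s≤s ih) (≤-reflexive (sym (+-suc _ _)))
    ... | yes p | no ¬q | no ¬r = ⊥-elim ([ ¬q , ¬r ]′ (P⊆Q∪R p))

    length-filter≤count : ∀ (_≟_ : DecidableEquality A) {m} (g : Fin m → A)
                          {Q : Pred (Fin m) 0ℓ} (Q? : Decidable Q) {P : Pred A 0ℓ} (P? : Decidable P) xs →
                          (∀ y → length (filter (_≟ y) xs) ≤ 1) →
                          (∀ {x} → P x → ∃ λ v → Q v × x ≡ g v) →
                          length (filter P? xs) ≤ count Q?
    length-filter≤count _≟_ {zero} g Q? P? xs unique P⊆g[Q] =
      ≤-reflexive (length-filter-∅ P? (λ _ p → case proj₁ (P⊆g[Q] p) of λ ()) xs)
    length-filter≤count _≟_ {suc m} g {Q} Q? {P} P? xs unique P⊆g[Q] with Q? zero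
    ... | yes _ = ≤-trans (length-filter-∪ P? (_≟ g zero) P′? split xs)
                          (+-mono-≤ (unique (g zero))
                                    (length-filter≤count _≟_ (g ∘ suc) (Q? ∘ suc) P′? xs unique P′⊆g[Q]))
      where
        P′ : Pred A 0ℓ
        P′ x = P x × x ≢ g zero
        P′? : Decidable P′
        P′? x = P? x ×-dec ¬? (x ≟ g zero)
        split : P ⊆ (_≡ g zero) ∪ P′
        split {x} p with x ≟ g zero
        ... | yes x≡g0 = inj₁ x≡g0
        ... | no x≢g0  = inj₂ (p , x≢g0)
        P′⊆g[Q] : ∀ {x} → P′ x → ∃ λ v → Q (suc v) × x ≡ g (suc v)
        P′⊆g[Q] (p , x≢g0) with P⊆g[Q] p
        ... | zero  , _ , x≡g0 = ⊥-elim (x≢g0 x≡g0)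
        ... | suc v , q , x≡gv = v , q , x≡gv
    ... | no ¬q0 = length-filter≤count _≟_ (g ∘ suc) (Q? ∘ suc) P? xs unique P⊆g[Q∘suc]
      where
        P⊆g[Q∘suc] : ∀ {x} → P x → ∃ λ v → Q (suc v) × x ≡ g (suc v)
        P⊆g[Q∘suc] p with P⊆g[Q] p
        ... | zero  , q0 , _ = ⊥-elim (¬q0 q0)
        ... | suc v , q , x≡gv = v , q , x≡gv

  length-filter-allSubsets : ∀ n {P : Pred (Subset (suc n)) 0ℓ} (P? : Decidable P) →
    length (filter P? (allSubsets (suc n))) ≡
    length (filter (P? ∘ (inside ∷_)) (allSubsets n)) + length (filter (P? ∘ (outside ∷_)) (allSubsets n))
  length-filter-allSubsets n P? =
    trans (length-filter-++ P? (map (inside ∷_) A) (map (outside ∷_) A))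
          (cong₂ _+_ (length-filter-map P? (inside ∷_) A) (length-filter-map P? (outside ∷_) A))
    where A = allSubsets n

  _≟ₛ_ : ∀ {n} → DecidableEquality (Subset n)
  _≟ₛ_ = ≡-dec _≟ᵇ_

  allSubsets-unique : ∀ n (p : Subset n) → length (filter (_≟ₛ p) (allSubsets n)) ≡ 1
  allSubsets-unique zero [] = refl
  allSubsets-unique (suc n) (b ∷ p) = trans (length-filter-allSubsets n (_≟ₛ (b ∷ p))) (split b)
    where
      A = allSubsets n
      tail≐ : ∀ b → (λ q → b ∷ q ≡ b ∷ p) ≐ (_≡ p)
      tail≐ b = (λ e → proj₂ (∷-injective e)) , cong (b ∷_)
      split : ∀ b → length (filter ((_≟ₛ (b ∷ p)) ∘ (inside ∷_)) A)
                    + length (filter ((_≟ₛ (b ∷ p)) ∘ (outside ∷_)) A) ≡ 1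
      split inside  = cong₂ _+_ (trans (length-filter-≐ _ _ (tail≐ inside) A) (allSubsets-unique n p))
                                (length-filter-∅ _ (λ _ ()) A)
      split outside = cong₂ _+_ (length-filter-∅ _ (λ _ ()) A)
                                (trans (length-filter-≐ _ _ (tail≐ outside) A) (allSubsets-unique n p))

  ∣∁p∣≡k⇒∣p∣≡n∸k : ∀ {n k} (p : Subset n) → ∣ ∁ p ∣ ≡ k → ∣ p ∣ ≡ n ∸ k
  ∣∁p∣≡k⇒∣p∣≡n∸k {n} {k} p ∣∁p∣≡k = begin
    ∣ p ∣             ≡⟨ m∸[m∸n]≡n (∣p∣≤n p) ⟨
    n ∸ (n ∸ ∣ p ∣)   ≡⟨ cong (n ∸_) (∣∁p∣≡n∸∣p∣ p) ⟨
    n ∸ ∣ ∁ p ∣       ≡⟨ cong (n ∸_) ∣∁p∣≡k ⟩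
    n ∸ k             ∎
    where open ≡-Reasoning

  CoSubset : ∀ {n} → Pred (Fin n) 0ℓ → ℕ → Subset n → Set
  CoSubset N m D = (∀ v → v ∈ D ⊎ N v) × ∣ ∁ D ∣ ≡ m

  CoSubset? : ∀ {n} {N : Pred (Fin n) 0ℓ} → Decidable N → ∀ m → Decidable (CoSubset N m)
  CoSubset? N? m D = all? (λ v → v ∈? D ⊎-dec N? v) ×-dec (∣ ∁ D ∣ ≟ℕ m)

  module _ {n} {N : Pred (Fin (suc n)) 0ℓ} where

    CoSubset-inside : ∀ {m} → (CoSubset N m ∘ (inside ∷_)) ≐ CoSubset (N ∘ suc) m
    CoSubset-inside = (λ (cover , size) → (λ v → map₁ drop-there (cover (suc v))) , size)
                    , (λ (cover , size) → (λ { zero → inj₁ here ; (suc v) → map₁ there (cover v) }) , size)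

    CoSubset-outside : ∀ {m} → N zero → (CoSubset N (suc m) ∘ (outside ∷_)) ≐ CoSubset (N ∘ suc) m
    CoSubset-outside n₀ = (λ (cover , size) → (λ v → map₁ drop-there (cover (suc v))) , suc-injective size)
                        , (λ (cover , size) → (λ { zero → inj₂ n₀ ; (suc v) → map₁ there (cover v) }) , cong suc size)

    CoSubset-outside-N : ∀ {m D} → CoSubset N m (outside ∷ D) → N zero
    CoSubset-outside-N (cover , _) with cover zero
    ... | inj₂ n₀ = n₀

  count-CoSubset : ∀ n {N : Pred (Fin n) 0ℓ} (N? : Decidable N) m →
                   length (filter (CoSubset? N? m) (allSubsets n)) ≡ count N? C m
  count-CoSubset zero N? m with CoSubset? N? m []
  ... | yes (_ , refl) = refl
  count-CoSubset zero N? zero    | no ¬c = ⊥-elim (¬c ((λ ()) , refl))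
  count-CoSubset zero N? (suc m) | no _  = refl
  count-CoSubset (suc n) {N} N? m = begin
    length (filter (CoSubset? N? m) (allSubsets (suc n)))
      ≡⟨ length-filter-allSubsets n (CoSubset? N? m) ⟩
    length (filter (CoSubset? N? m ∘ (inside ∷_)) A) + length (filter (CoSubset? N? m ∘ (outside ∷_)) A)
      ≡⟨ cong (_+ length (filter (CoSubset? N? m ∘ (outside ∷_)) A))
              (trans (length-filter-≐ _ _ CoSubset-inside A) (count-CoSubset n (N? ∘ suc) m)) ⟩
    count (N? ∘ suc) C m + length (filter (CoSubset? N? m ∘ (outside ∷_)) A)
      ≡⟨ pascal m (N? zero) ⟩
    count N? C m ∎
    where
      open ≡-Reasoning
      A = allSubsets n
      c = count (N? ∘ suc)
      pascal : ∀ m → Dec (N zero) → c C m + length (filter (CoSubset? N? m ∘ (outside ∷_)) A) ≡ count N? C m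
      pascal zero _ = cong (c C 0 +_) (length-filter-∅ _ (λ { _ (_ , ()) }) A)
      pascal (suc m) (yes n₀) = begin
        c C suc m + length (filter (CoSubset? N? (suc m) ∘ (outside ∷_)) A)
          ≡⟨ cong (c C suc m +_) (trans (length-filter-≐ _ _ (CoSubset-outside n₀) A) (count-CoSubset n (N? ∘ suc) m)) ⟩
        c C suc m + c C m   ≡⟨ +-comm (c C suc m) (c C m) ⟩
        c C m + c C suc m   ≡⟨ nCk+nC[k+1]≡[n+1]C[k+1] c m ⟩
        suc c C suc m       ≡⟨ cong (_C suc m) (count-yes N? n₀) ⟨
        count N? C suc m    ∎
      pascal (suc m) (no ¬n₀) = begin
        c C suc m + length (filter (CoSubset? N? (suc m) ∘ (outside ∷_)) A)
          ≡⟨ cong (c C suc m +_) (length-filter-∅ _ (λ _ → ¬n₀ ∘ CoSubset-outside-N) A) ⟩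
        c C suc m + 0       ≡⟨ +-identityʳ _ ⟩
        c C suc m           ≡⟨ cong (_C suc m) (count-no N? ¬n₀) ⟨
        count N? C suc m    ∎

  [m+n]C2≡mC2+m*n+nC2 : ∀ m n → (m + n) C 2 ≡ m C 2 + m * n + n C 2
  [m+n]C2≡mC2+m*n+nC2 m zero = trans (cong (_C 2) (+-identityʳ m)) (pad (m C 2) m)
    where
      pad : ∀ a m → a ≡ a + m * 0 + 0
      pad = solve-∀
  [m+n]C2≡mC2+m*n+nC2 m (suc n) = begin
    (m + suc n) C 2                     ≡⟨ cong (_C 2) (+-suc m n) ⟩
    suc (m + n) C 2                     ≡⟨ nCk+nC[k+1]≡[n+1]C[k+1] (m + n) 1 ⟨
    (m + n) C 1 + (m + n) C 2           ≡⟨ cong₂ _+_ (nC1≡n (m + n)) ([m+n]C2≡mC2+m*n+nC2 m n) ⟩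
    (m + n) + (m C 2 + m * n + n C 2)   ≡⟨ rearrange (m C 2) (n C 2) m n ⟩
    m C 2 + (m + m * n) + (n + n C 2)   ≡⟨ cong₂ (λ x y → m C 2 + x + y) (sym (*-suc m n)) (cong (_+ n C 2) (sym (nC1≡n n))) ⟩
    m C 2 + m * suc n + (n C 1 + n C 2) ≡⟨ cong (m C 2 + m * suc n +_) (nCk+nC[k+1]≡[n+1]C[k+1] n 1) ⟩
    m C 2 + m * suc n + suc n C 2       ∎
    where
      open ≡-Reasoning
      rearrange : ∀ a b m n → (m + n) + (a + m * n + b) ≡ a + (m + m * n) + (n + b)
      rearrange = solve-∀

  module _ {n} (G : Graph n) where

    NonSupporting? : Decidable (∁ᵖ (Supporting G))
    NonSupporting? = ∁? (Supporting? G)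

    nonNeighbours : Fin n → Subset n
    nonNeighbours v = tabulate (λ u → not (adj G v u))

    Dominates : Subset n → Fin n → Set
    Dominates D v = ∃ λ u → u ∈ D × Adj G v u

    pendant-neighbour-supporting : ∀ {v w} → Adj G v w → Pendant G v → Supporting G w
    pendant-neighbour-supporting {v} {w} v~w pendant = v , trans (adj-sym G w v) v~w , pendant

    undominated⇒degree2 : (∀ v → ∃ (Adj G v)) → ∀ {D} → CoSubset (∁ᵖ (Supporting G)) 2 D →
                          ∀ {v} → ¬ Dominates D v → degree G v ≡ 2 × D ≡ nonNeighbours v
    undominated⇒degree2 hasNeighbour {D} (cover , ∣∁D∣≡2) {v} undominated = degree≡2 , D≡nonNeighbours
      where
        Outside? : Decidable (λ u → lookup D u ≡ outside)
        Outside? u = lookup D u ≟ᵇ outside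

        adjacent⇒outside : ∀ {u} → Adj G v u → lookup D u ≡ outside
        adjacent⇒outside {u} v~u = ¬-not (λ inD → undominated (u , lookup⇒[]= u D inD , v~u))

        w = proj₁ (hasNeighbour v)
        v~w = proj₂ (hasNeighbour v)

        w-nonSupporting : ¬ Supporting G w
        w-nonSupporting = [ (λ w∈D → ⊥-elim (undominated (w , w∈D , v~w))) , id ]′ (cover w)

        outside⇒adjacent : ∀ {u} → lookup D u ≡ outside → Adj G v u
        outside⇒adjacent {u} out with Adj? G v u
        ... | yes v~u = v~u
        ... | no ¬v~u = ⊥-elim (w-nonSupporting (pendant-neighbour-supporting v~w pendant))
          where
            degree<2 : degree G v < 2
            degree<2 = subst (degree G v <_) (trans (count-outside≡∣∁∣ D) ∣∁D∣≡2)
                             (count-mono-< (Adj? G v) Outside? adjacent⇒outside out ¬v~u)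
            pendant : Pendant G v
            pendant = ≤-antisym (≤-pred degree<2) (count-pos (Adj? G v) v~w)

        degree≡2 : degree G v ≡ 2
        degree≡2 = trans (count-cong (Adj? G v) Outside? (adjacent⇒outside , outside⇒adjacent))
                         (trans (count-outside≡∣∁∣ D) ∣∁D∣≡2)

        lookup≢adj : ∀ u → lookup D u ≢ adj G v u
        lookup≢adj u e with lookup D u in inD?
        ... | inside  = case trans (sym inD?) (adjacent⇒outside (sym e)) of λ ()
        ... | outside = case trans e (outside⇒adjacent inD?) of λ ()

        D≡nonNeighbours : D ≡ nonNeighbours v
        D≡nonNeighbours = trans (sym (tabulate∘lookup D)) (tabulate-cong (λ u → ¬-not (lookup≢adj u)))

    nonSupportingC2≤dt+numDegree2 : (∀ v → ∃ (Adj G v)) → count NonSupporting? C 2 ≤ dt G (n ∸ 2) + numDegree2 G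
    nonSupportingC2≤dt+numDegree2 hasNeighbour = begin
      count NonSupporting? C 2                                  ≡⟨ count-CoSubset n NonSupporting? 2 ⟨
      length (filter Candidate? Ds)                             ≤⟨ length-filter-∪ Candidate? Dominating? Undominated? split Ds ⟩
      length (filter Dominating? Ds) + length (filter Undominated? Ds)
        ≤⟨ +-monoʳ-≤ (dt G (n ∸ 2))
             (length-filter≤count _≟ₛ_ nonNeighbours (λ v → degree G v ≟ℕ 2) Undominated? Ds
                (≤-reflexive ∘ allSubsets-unique n) undominated⇒nonNeighbours) ⟩
      dt G (n ∸ 2) + numDegree2 G                               ∎
      where
        open ≤-Reasoning
        Ds = allSubsets n
        Candidate = CoSubset (∁ᵖ (Supporting G)) 2
        Candidate? = CoSubset? NonSupporting? 2
        Dominating? : Decidable (λ D → TotalDominating G D × ∣ D ∣ ≡ n ∸ 2)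
        Dominating? D = TotalDominating? G D ×-dec (∣ D ∣ ≟ℕ (n ∸ 2))
        Undominated? : Decidable (λ D → Candidate D × ¬ TotalDominating G D)
        Undominated? D = Candidate? D ×-dec ¬? (TotalDominating? G D)

        split : Candidate ⊆ (λ D → TotalDominating G D × ∣ D ∣ ≡ n ∸ 2) ∪ (λ D → Candidate D × ¬ TotalDominating G D)
        split {D} candidate with TotalDominating? G D
        ... | yes total = inj₁ (total , ∣∁p∣≡k⇒∣p∣≡n∸k D (proj₂ candidate))
        ... | no ¬total = inj₂ (candidate , ¬total)

        undominated⇒nonNeighbours : ∀ {D} → Candidate D × ¬ TotalDominating G D →
                                     ∃ λ v → degree G v ≡ 2 × D ≡ nonNeighbours v
        undominated⇒nonNeighbours {D} (candidate , ¬total) =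
          let v , ¬dominated = ¬∀⟶∃¬ n (Dominates D) (λ v → any? (λ u → u ∈? D ×-dec Adj? G v u)) ¬total
          in v , undominated⇒degree2 hasNeighbour candidate ¬dominated

  connected⇒neighbour : ∀ {k} (G : Graph (suc (suc k))) → Connected G → ∀ v → ∃ (Adj G v)
  connected⇒neighbour G connected zero with connected zero (suc zero)
  ... | v~w ◅ _ = _ , v~w
  connected⇒neighbour G connected (suc v) with connected (suc v) zero
  ... | v~w ◅ _ = _ , v~w

  nC2≤numDegree2+dt+r*[n∸r]+rC2 : ∀ n (G : Graph n) → Connected G → let r = numSupporting G in
             n C 2 ≤ numDegree2 G + dt G (n ∸ 2) + r * (n ∸ r) + r C 2
  nC2≤numDegree2+dt+r*[n∸r]+rC2 0 G _ = z≤n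
  nC2≤numDegree2+dt+r*[n∸r]+rC2 1 G _ = z≤n
  nC2≤numDegree2+dt+r*[n∸r]+rC2 n@(suc (suc _)) G connected = begin
    n C 2                                            ≡⟨ cong (_C 2) (count+count-∁ (Supporting? G)) ⟨
    (r + s) C 2                                      ≡⟨ [m+n]C2≡mC2+m*n+nC2 r s ⟩
    r C 2 + r * s + s C 2
      ≤⟨ +-monoʳ-≤ (r C 2 + r * s) (nonSupportingC2≤dt+numDegree2 G (connected⇒neighbour G connected)) ⟩
    r C 2 + r * s + (dt G (n ∸ 2) + numDegree2 G)    ≡⟨ rearrange (r C 2) (r * s) (dt G (n ∸ 2)) (numDegree2 G) ⟩
    numDegree2 G + dt G (n ∸ 2) + r * s + r C 2      ≡⟨ cong (λ t → numDegree2 G + dt G (n ∸ 2) + r * t + r C 2) n∸r≡s ⟨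
    numDegree2 G + dt G (n ∸ 2) + r * (n ∸ r) + r C 2 ∎
    where
      open ≤-Reasoning
      r = numSupporting G
      s = count (NonSupporting? G)
      n∸r≡s : n ∸ r ≡ s
      n∸r≡s = trans (cong (_∸ r) (sym (count+count-∁ (Supporting? G)))) (m+n∸m≡n r s)
      rearrange : ∀ a b c d → a + b + (c + d) ≡ d + c + b + a
      rearrange = solve-∀

open import Defs using (Graph; Connected; Supporting?; numSupporting; numDegree2; dt)
open import Data.Nat using (ℕ; _∸_)
open import Data.Nat.Combinatorics using (_C_)
open import Data.Integer using (+_; _-_; _*_; _≤_; -_; _⊖_; +≤+)
open import Data.Integer.Properties using (≤-trans; ≤-reflexive; +-monoˡ-≤; [+m]-[+n]≡m⊖n; ⊖-≥; pos-*)
import Data.Nat as ℕ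
import Data.Nat.Properties as ℕ
open import Relation.Binary.PropositionalEquality using (_≡_; cong; sym; subst; module ≡-Reasoning)

open NaturalBound using (nC2≤numDegree2+dt+r*[n∸r]+rC2; count≤n)

i≤+[j+k]⇒i-k≤+j : ∀ {i} j k → i ≤ + (j ℕ.+ k) → i - + k ≤ + j
i≤+[j+k]⇒i-k≤+j j k i≤j+k = ≤-trans (+-monoˡ-≤ (- + k) i≤j+k) (≤-reflexive (begin
  + (j ℕ.+ k) - + k   ≡⟨ [+m]-[+n]≡m⊖n (j ℕ.+ k) k ⟩
  (j ℕ.+ k) ⊖ k       ≡⟨ ⊖-≥ (ℕ.m≤n+m k j) ⟩
  + (j ℕ.+ k ∸ k)     ≡⟨ cong +_ (ℕ.m+n∸n≡m j k) ⟩
  + j                 ∎))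
  where open ≡-Reasoning

+m*[+n-+m]≡+[m*[n∸m]] : ∀ {m n} → m ℕ.≤ n → + m * (+ n - + m) ≡ + (m ℕ.* (n ∸ m))
+m*[+n-+m]≡+[m*[n∸m]] {m} {n} m≤n = begin
  + m * (+ n - + m)   ≡⟨ cong (+ m *_) ([+m]-[+n]≡m⊖n n m) ⟩
  + m * (n ⊖ m)       ≡⟨ cong (+ m *_) (⊖-≥ m≤n) ⟩
  + m * + (n ∸ m)     ≡⟨ pos-* m (n ∸ m) ⟨
  + (m ℕ.* (n ∸ m))   ∎
  where open ≡-Reasoning

theorem8 : ∀ (n : ℕ) (G : Graph n) → Connected G →
    let r = numSupporting G in
    + (n C 2) - + (r C 2) - (+ r) * (+ n - + r) - + dt G (n ∸ 2) ≤ + numDegree2 G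
theorem8 n G connected =
  subst (λ t → + (n C 2) - + (r C 2) - t - + dt G (n ∸ 2) ≤ + numDegree2 G)
        (sym (+m*[+n-+m]≡+[m*[n∸m]] (count≤n (Supporting? G))))
        (i≤+[j+k]⇒i-k≤+j _ _ (i≤+[j+k]⇒i-k≤+j _ _ (i≤+[j+k]⇒i-k≤+j _ _ (+≤+ (nC2≤numDegree2+dt+r*[n∸r]+rC2 n G connected)))))
  where r = numSupporting G
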